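{- For every graph $G$, $\dim(G)\leq\psi(G)\leq 2\gamma_M(G)\leq 2\gamma_L(G)$.
   Context: All graphs are finite, simple, undirected and connected, with at least $2$ vertices; $d(u,v)$ is the length of a shortest $u$-$v$ path and $N(x)$ is the set of neighbors of $x$. A set $S\subseteq V(G)$ is a resolving set if for every two distinct vertices $x,y$ there is $u\in S$ with $d(u,x)\neq d(u,y)$; $\dim(G)$ is the minimum size of a resolving set. $S$ is a dominating set if every vertex not in $S$ has a neighbor in $S$. $S$ is a metric-locating-dominating set if it is both resolving and dominating; $\gamma_M(G)$ is its minimum size. $S$ is a locating-dominating set if it is dominating and $N(x)\cap S\neq N(y)\cap S$ for all distinct $x,y\in V(G)\setminus S$; $\gamma_L(G)$ is its minimum size. Two vertices $u,v$ doubly resolve a pair $\{x,y\}$ if $d(u,x)-d(u,y)\neq d(v,x)-d(v,y)$; $S$ is a doubly resolving set if every pair of distinct vertices is doubly resolved by some two vertices of $S$; $\psi(G)$ is its minimum size. -}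

module Defs where

open import Data.Nat using (ℕ; zero; suc; _≤_; _+_)
open import Data.Bool using (Bool; true; false; _∨_; _∧_; if_then_else_)
open import Data.Fin using (Fin)
open import Data.Fin.Subset using (Subset; _∈_; _∉_; _∩_; ∣_∣)
open import Data.Vec using (tabulate)
open import Data.Integer using (ℤ; +_; _-_)
open import Data.Product using (Σ; ∃; _×_; _,_)
open import Relation.Binary.PropositionalEquality using (_≡_; _≢_)
open import Relation.Nullary using (¬_)
open import Relation.Nullary.Decidable using (⌊_⌋)
open import Data.Fin using (_≟_)

anyFin : (n : ℕ) → (Fin n → Bool) → Bool
anyFin zero    f = false
anyFin (suc n) f = f Fin.zero ∨ anyFin n (λ i → f (Fin.suc i))

data Walk {n : ℕ} (adj : Fin n → Fin n → Bool) : Fin n → Fin n → ℕ → Set where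
  here  : ∀ {u} → Walk adj u u 0
  step  : ∀ {u w v k} → adj u w ≡ true → Walk adj w v k → Walk adj u v (suc k)

record Graph : Set where
  field
    n         : ℕ
    two≤n     : 2 ≤ n
    adj       : Fin n → Fin n → Bool
    symmetric : ∀ u v → adj u v ≡ adj v u
    irrefl    : ∀ u → adj u u ≡ false
    connected : ∀ u v → ∃ λ k → Walk adj u v k

open Graph public

module _ (G : Graph) where
  private
    V = Fin (n G)

  walkOf : ℕ → V → V → Bool
  walkOf zero    u v = ⌊ u ≟ v ⌋
  walkOf (suc k) u v = anyFin (n G) (λ w → adj G u w ∧ walkOf k w v)

  search : ℕ → ℕ → V → V → ℕ
  search zero       start u v = start
  search (suc fuel) start u v =
    if walkOf start u v then start else search fuel (suc start) u v

  -- d(u,v): length of a shortest u-v walk (= shortest path).  In a connected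
  -- graph on n vertices this is < n, so searching k = 0,1,...,n-1 suffices.
  d : V → V → ℕ
  d u v = search (n G) 0 u v

  N : V → Subset (n G)
  N x = tabulate (adj G x)

  IsResolving : Subset (n G) → Set
  IsResolving S = ∀ (x y : V) → x ≢ y → Σ V λ u → u ∈ S × d u x ≢ d u y

  IsDominating : Subset (n G) → Set
  IsDominating S = ∀ (x : V) → x ∉ S → Σ V λ u → u ∈ S × adj G x u ≡ true

  IsMetricLocatingDominating : Subset (n G) → Set
  IsMetricLocatingDominating S = IsResolving S × IsDominating S

  IsLocatingDominating : Subset (n G) → Set
  IsLocatingDominating S =
    IsDominating S ×
    (∀ (x y : V) → x ≢ y → x ∉ S → y ∉ S → (N x ∩ S) ≢ (N y ∩ S))

  DoublyResolve : V → V → V → V → Set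
  DoublyResolve u v x y = (+ d u x) - (+ d u y) ≢ (+ d v x) - (+ d v y)

  IsDoublyResolving : Subset (n G) → Set
  IsDoublyResolving S = ∀ (x y : V) → x ≢ y →
    Σ V λ u → Σ V λ v → u ∈ S × v ∈ S × DoublyResolve u v x y

  IsMinSize : (Subset (n G) → Set) → ℕ → Set
  IsMinSize P k = (Σ (Subset (n G)) λ S → P S × ∣ S ∣ ≡ k)
                × (∀ S → P S → k ≤ ∣ S ∣)

  IsDim : ℕ → Set
  IsDim = IsMinSize IsResolving

  IsPsi : ℕ → Set
  IsPsi = IsMinSize IsDoublyResolving

  IsGammaM : ℕ → Set
  IsGammaM = IsMinSize IsMetricLocatingDominating

  IsGammaL : ℕ → Set
  IsGammaL = IsMinSize IsLocatingDominating

-- dim ≤ ψ: of two vertices doubly resolving {x,y}, at least one resolves it.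
-- γ_M ≤ γ_L: for x, y ∉ S with different traces N(x) ∩ S ≠ N(y) ∩ S, a vertex of
-- S adjacent to exactly one of them is at distance 1 from one and not the other.
-- ψ ≤ 2γ_M: add to a metric-locating-dominating set S, for each s ∈ S, the vertex
-- x (unique, since S is resolving) with d(s′,x) = d(s′,s) + 1 for all s′ ∈ S.
-- If the enlarged set S′ does not doubly resolve {x,y}, then d(u,x) − d(u,y) is
-- the same for all u ∈ S′.  If x ∈ S′ and y ∉ S′, a neighbour s ∈ S of y gives
-- d(s,x) + d(x,y) = 1, so s = x and y is the vertex added for x, a contradiction.
-- If x, y ∉ S′, their neighbours in S show the constant difference is 0, so S
-- does not resolve {x,y}.
module Submission where

open import Defs
open import Data.Nat using (ℕ; zero; suc; _+_; _*_; _≤_; _<_; z≤n; s≤s)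
import Data.Nat as ℕ
open import Data.Nat.Properties
  using (≤-trans; ≤-reflexive; n≤1+n; +-monoʳ-≤; +-suc; <-irrefl; +-identityʳ; +-comm; +-mono-≤; *-monoʳ-≤; m+n≡0⇒m≡0; suc-injective)
open import Data.Bool using (Bool; true; false; _∧_)
open import Data.Bool.Properties using (∨-zeroʳ)
open import Data.Fin using (Fin; _≟_)
import Data.Fin as Fin
open import Data.Fin.Properties using (¬∀⟶∃¬; all?)
open import Data.Fin.Subset using (Subset; _∈_; _∉_; _∩_; _∪_; _⊆_; ∣_∣; ⋃; ⁅_⁆)
open import Data.Fin.Subset.Properties
  using (_∈?_; x∈p∩q⁺; x∈p∩q⁻; p⊆p∪q; q⊆p∪q; ⊆-antisym; p⊆q⇒∣p∣≤∣q∣;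
         nonempty?; Empty-unique; drop-there; ∣⊥∣≡0; ∣⁅x⁆∣≡1; x∈⁅x⁆)
open import Data.Vec using ([]; _∷_; tabulate)
open import Data.Vec.Properties using (lookup∘tabulate; lookup⇒[]=; []=⇒lookup)
import Data.List as List
open import Data.Integer using (+_; _-_)
import Data.Integer as ℤ
open import Data.Integer.Properties using (+-injective; pos-+; i≡j⇒i-j≡0)
open import Data.Integer.Tactic.RingSolver using (solve-∀)
open import Data.Product using (Σ; ∃; _×_; _,_; proj₁)
open import Data.Sum using (_⊎_; inj₁; inj₂)
open import Data.Empty using (⊥-elim)
open import Function using (_∘_)
open import Level using (Level)
open import Relation.Binary.PropositionalEquality
open import Relation.Nullary using (¬_; Dec; yes; no)
open import Relation.Nullary.Decidable using (⌊_⌋; _×-dec_; _→-dec_)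
open import Relation.Unary using (Pred; Decidable)

private
  variable
    p q : Level
    m : ℕ

⌊⌋≡true⇒ : ∀ {A : Set p} (a? : Dec A) → ⌊ a? ⌋ ≡ true → A
⌊⌋≡true⇒ (yes a) _ = a

⌊⌋≡true : ∀ {A : Set p} (a? : Dec A) → A → ⌊ a? ⌋ ≡ true
⌊⌋≡true (yes _) _ = refl
⌊⌋≡true (no ¬a) a = ⊥-elim (¬a a)

⌊⌋≡false : ∀ {A : Set p} (a? : Dec A) → ¬ A → ⌊ a? ⌋ ≡ false
⌊⌋≡false (yes a) ¬a = ⊥-elim (¬a a)
⌊⌋≡false (no _)  _  = refl

¬∀⟶∃¬-restricted : {P : Pred (Fin m) p} {Q : Pred (Fin m) q} → Decidable P → Decidable Q →
                   ¬ (∀ i → P i → Q i) → ∃ λ i → P i × ¬ Q i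
¬∀⟶∃¬-restricted {m} P? Q? ¬∀ with ¬∀⟶∃¬ m _ (λ i → P? i →-dec Q? i) ¬∀
... | i , ¬P⇒Q with P? i
...   | yes pi = i , pi , λ qi → ¬P⇒Q (λ _ → qi)
...   | no ¬pi = ⊥-elim (¬P⇒Q (λ pi → ⊥-elim (¬pi pi)))

anyFin⁻ : ∀ m f → anyFin m f ≡ true → ∃ λ i → f i ≡ true
anyFin⁻ (suc m) f h with f Fin.zero in eq
... | true  = Fin.zero , eq
... | false with anyFin⁻ m (λ i → f (Fin.suc i)) h
...   | i , fi = Fin.suc i , fi

anyFin⁺ : ∀ m f i → f i ≡ true → anyFin m f ≡ true
anyFin⁺ (suc m) f Fin.zero    fi rewrite fi = refl
anyFin⁺ (suc m) f (Fin.suc i) fi rewrite anyFin⁺ m (λ j → f (Fin.suc j)) i fi = ∨-zeroʳ (f Fin.zero)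

∈-tabulate⁺ : (f : Fin m → Bool) {x : Fin m} → f x ≡ true → x ∈ tabulate f
∈-tabulate⁺ f {x} fx = lookup⇒[]= x _ (trans (lookup∘tabulate f x) fx)

∈-tabulate⁻ : (f : Fin m → Bool) {x : Fin m} → x ∈ tabulate f → f x ≡ true
∈-tabulate⁻ f {x} x∈ = trans (sym (lookup∘tabulate f x)) ([]=⇒lookup x∈)

filter : {P : Pred (Fin m) p} → Decidable P → Subset m
filter P? = tabulate (λ x → ⌊ P? x ⌋)

∈-filter⁺ : {P : Pred (Fin m) p} (P? : Decidable P) {x : Fin m} → P x → x ∈ filter P?
∈-filter⁺ P? {x} px = ∈-tabulate⁺ _ (⌊⌋≡true (P? x) px)

∈-filter⁻ : {P : Pred (Fin m) p} (P? : Decidable P) {x : Fin m} → x ∈ filter P? → P x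
∈-filter⁻ P? {x} x∈ = ⌊⌋≡true⇒ (P? x) (∈-tabulate⁻ _ x∈)

∈⋃-tabulate⁺ : ∀ {k m} (F : Fin k → Subset m) i {x} → x ∈ F i → x ∈ ⋃ (List.tabulate F)
∈⋃-tabulate⁺ F Fin.zero    x∈ = p⊆p∪q _ x∈
∈⋃-tabulate⁺ F (Fin.suc i) x∈ = q⊆p∪q (F Fin.zero) _ (∈⋃-tabulate⁺ (F ∘ Fin.suc) i x∈)

∣p∪q∣≤∣p∣+∣q∣ : (s t : Subset m) → ∣ s ∪ t ∣ ≤ ∣ s ∣ + ∣ t ∣
∣p∪q∣≤∣p∣+∣q∣ [] [] = z≤n
∣p∪q∣≤∣p∣+∣q∣ (true  ∷ s) (true  ∷ t) = s≤s (≤-trans (∣p∪q∣≤∣p∣+∣q∣ s t) (+-monoʳ-≤ ∣ s ∣ (n≤1+n ∣ t ∣)))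
∣p∪q∣≤∣p∣+∣q∣ (true  ∷ s) (false ∷ t) = s≤s (∣p∪q∣≤∣p∣+∣q∣ s t)
∣p∪q∣≤∣p∣+∣q∣ (false ∷ s) (true  ∷ t) rewrite +-suc ∣ s ∣ ∣ t ∣ = s≤s (∣p∪q∣≤∣p∣+∣q∣ s t)
∣p∪q∣≤∣p∣+∣q∣ (false ∷ s) (false ∷ t) = ∣p∪q∣≤∣p∣+∣q∣ s t

∣p∣≤1 : ∀ {m} (s : Subset m) → (∀ {x y} → x ∈ s → y ∈ s → x ≡ y) → ∣ s ∣ ≤ 1
∣p∣≤1 {m} s unique with nonempty? s
... | yes (x , x∈s) = ≤-trans (p⊆q⇒∣p∣≤∣q∣ s⊆⁅x⁆) (≤-reflexive (∣⁅x⁆∣≡1 x))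
  where
  s⊆⁅x⁆ : s ⊆ ⁅ x ⁆
  s⊆⁅x⁆ y∈s rewrite unique y∈s x∈s = x∈⁅x⁆ x
... | no empty = ≤-trans (≤-reflexive (trans (cong ∣_∣ (Empty-unique empty)) (∣⊥∣≡0 m))) z≤n

∣⋃∣≤∣p∣ : ∀ {k m} (F : Fin k → Subset m) (s : Subset k) →
          (∀ i → ∣ F i ∣ ≤ 1) → (∀ i → i ∉ s → ∣ F i ∣ ≡ 0) →
          ∣ ⋃ (List.tabulate F) ∣ ≤ ∣ s ∣
∣⋃∣≤∣p∣ {m = m} F [] _ _ = ≤-reflexive (∣⊥∣≡0 m)
∣⋃∣≤∣p∣ F (true ∷ s) ≤1 outside≡0 =
  ≤-trans (∣p∪q∣≤∣p∣+∣q∣ (F Fin.zero) _) (+-mono-≤ (≤1 Fin.zero)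
    (∣⋃∣≤∣p∣ (F ∘ Fin.suc) s (≤1 ∘ Fin.suc) (λ i i∉s → outside≡0 (Fin.suc i) (i∉s ∘ drop-there))))
∣⋃∣≤∣p∣ F (false ∷ s) ≤1 outside≡0 =
  ≤-trans (∣p∪q∣≤∣p∣+∣q∣ (F Fin.zero) _) (+-mono-≤ (≤-reflexive (outside≡0 Fin.zero λ ()))
    (∣⋃∣≤∣p∣ (F ∘ Fin.suc) s (≤1 ∘ Fin.suc) (λ i i∉s → outside≡0 (Fin.suc i) (i∉s ∘ drop-there))))

+m-+n≡+o-+p⇒m+p≡o+n : ∀ m n o p → + m - + n ≡ + o - + p → m + p ≡ o + n
+m-+n≡+o-+p⇒m+p≡o+n m n o p eq = +-injective (begin
    + (m + p)                     ≡⟨ pos-+ m p ⟩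
    + m ℤ.+ + p                   ≡⟨ shift (+ m) (+ n) (+ p) ⟩
    (+ m - + n) ℤ.+ (+ n ℤ.+ + p) ≡⟨ cong (ℤ._+ (+ n ℤ.+ + p)) eq ⟩
    (+ o - + p) ℤ.+ (+ n ℤ.+ + p) ≡⟨ unshift (+ o) (+ p) (+ n) ⟩
    + o ℤ.+ + n                   ≡⟨ pos-+ o n ⟨
    + (o + n)                     ∎)
  where
  open ≡-Reasoning
  shift : ∀ i j l → i ℤ.+ l ≡ (i - j) ℤ.+ (j ℤ.+ l)
  shift = solve-∀
  unshift : ∀ k l j → (k - l) ℤ.+ (j ℤ.+ l) ≡ k ℤ.+ j
  unshift = solve-∀

m+n≡1⇒m≡0 : ∀ m n → m + n ≡ 1 → n ≢ 0 → m ≡ 0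
m+n≡1⇒m≡0 zero          _       _  _   = refl
m+n≡1⇒m≡0 (suc zero)    zero    _  n≢0 = ⊥-elim (n≢0 refl)
m+n≡1⇒m≡0 (suc zero)    (suc _) ()
m+n≡1⇒m≡0 (suc (suc _)) _       ()

m+n≡2⇒n≡1 : ∀ m n → m + n ≡ 2 → m ≢ 0 → n ≢ 0 → n ≡ 1
m+n≡2⇒n≡1 zero             _             _  m≢0 _   = ⊥-elim (m≢0 refl)
m+n≡2⇒n≡1 (suc _)          zero          _  _   n≢0 = ⊥-elim (n≢0 refl)
m+n≡2⇒n≡1 (suc zero)       (suc zero)    _  _   _   = refl
m+n≡2⇒n≡1 (suc zero)       (suc (suc _)) ()
m+n≡2⇒n≡1 (suc (suc zero)) (suc _)       ()
m+n≡2⇒n≡1 (suc (suc (suc _))) (suc _)    ()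

module _ (G : Graph) where
  private
    V = Fin (n G)

  search≡start⊎hit : ∀ fuel start (u v : V) →
    search G fuel start u v ≡ start + fuel ⊎ walkOf G (search G fuel start u v) u v ≡ true
  search≡start⊎hit zero       start u v = inj₁ (sym (+-identityʳ start))
  search≡start⊎hit (suc fuel) start u v with walkOf G start u v in hit
  ... | true  = inj₂ hit
  ... | false with search≡start⊎hit fuel (suc start) u v
  ...   | inj₁ exhausted = inj₁ (trans exhausted (sym (+-suc start fuel)))
  ...   | inj₂ found     = inj₂ found

  walkOf-d : ∀ {k} (u v : V) → d G u v ≡ k → k < n G → walkOf G k u v ≡ true
  walkOf-d u v refl d<n with search≡start⊎hit (n G) 0 u v
  ... | inj₁ d≡n  = ⊥-elim (<-irrefl d≡n d<n)
  ... | inj₂ found = found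

  walkOf-1⇒adj : ∀ (u v : V) → walkOf G 1 u v ≡ true → adj G u v ≡ true
  walkOf-1⇒adj u v walk with anyFin⁻ (n G) _ walk
  ... | w , uw∧w≡v with adj G u w in uw
  ...   | true rewrite ⌊⌋≡true⇒ (w ≟ v) uw∧w≡v = uw

  adj⇒walkOf-1 : ∀ (u v : V) → adj G u v ≡ true → walkOf G 1 u v ≡ true
  adj⇒walkOf-1 u v uv = anyFin⁺ (n G) _ v (cong₂ _∧_ uv (⌊⌋≡true (v ≟ v) refl))

  adj-sym : ∀ {u v : V} → adj G u v ≡ true → adj G v u ≡ true
  adj-sym {u} {v} uv = trans (symmetric G v u) uv

  adj⇒≢ : ∀ {u v : V} → adj G u v ≡ true → u ≢ v
  adj⇒≢ {u} uv refl with () ← trans (sym (irrefl G u)) uv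

  d-refl : ∀ (u : V) → d G u u ≡ 0
  d-refl u = search-hit (n G) (two≤n G)
    where
    search-hit : ∀ fuel → 2 ≤ fuel → search G fuel 0 u u ≡ 0
    search-hit (suc _) (s≤s _) rewrite ⌊⌋≡true (u ≟ u) refl = refl

  d≡0⇒≡ : ∀ {u v : V} → d G u v ≡ 0 → u ≡ v
  d≡0⇒≡ {u} {v} d≡0 = ⌊⌋≡true⇒ (u ≟ v) (walkOf-d u v d≡0 (≤-trans (s≤s z≤n) (two≤n G)))

  d≡1⇒adj : ∀ {u v : V} → d G u v ≡ 1 → adj G u v ≡ true
  d≡1⇒adj {u} {v} d≡1 = walkOf-1⇒adj u v (walkOf-d u v d≡1 (two≤n G))

  adj⇒d≡1 : ∀ {u v : V} → adj G u v ≡ true → d G u v ≡ 1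
  adj⇒d≡1 {u} {v} uv = search-at-1 (n G) (two≤n G)
    where
    search-at-1 : ∀ fuel → 2 ≤ fuel → search G fuel 0 u v ≡ 1
    search-at-1 (suc (suc _)) (s≤s (s≤s _))
      rewrite ⌊⌋≡false (u ≟ v) (adj⇒≢ uv) | adj⇒walkOf-1 u v uv = refl

  Unresolved : Subset (n G) → V → V → Set
  Unresolved S x y = ∀ u → u ∈ S → d G u x ≡ d G u y

  -- d(u,x) − d(u,y) does not depend on u ∈ S, written without subtraction.
  DoublyUnresolved : Subset (n G) → V → V → Set
  DoublyUnresolved S x y = ∀ u v → u ∈ S → v ∈ S → d G u x + d G v y ≡ d G v x + d G u y

  ¬unresolved⇒resolving : ∀ {S} → (∀ x y → x ≢ y → ¬ Unresolved S x y) → IsResolving G S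
  ¬unresolved⇒resolving {S} ¬unresolved x y x≢y =
    ¬∀⟶∃¬-restricted (_∈? S) (λ u → d G u x ℕ.≟ d G u y) (¬unresolved x y x≢y)

  resolving⇒¬unresolved : ∀ {S} → IsResolving G S → ∀ {x y} → x ≢ y → ¬ Unresolved S x y
  resolving⇒¬unresolved resolving {x} {y} x≢y unresolved with resolving x y x≢y
  ... | u , u∈S , resolved = resolved (unresolved u u∈S)

  cross-sum? : ∀ x y u v → Dec (d G u x + d G v y ≡ d G v x + d G u y)
  cross-sum? x y u v = d G u x + d G v y ℕ.≟ d G v x + d G u y

  ¬doublyUnresolved⇒doublyResolving : ∀ {S} → (∀ x y → x ≢ y → ¬ DoublyUnresolved S x y) →
                                      IsDoublyResolving G S
  ¬doublyUnresolved⇒doublyResolving {S} ¬unresolved x y x≢y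
    with ¬∀⟶∃¬-restricted (_∈? S) (λ u → all? λ v → (v ∈? S) →-dec cross-sum? x y u v)
           (λ all → ¬unresolved x y x≢y λ u v u∈S v∈S → all u u∈S v v∈S)
  ... | u , u∈S , ¬all with ¬∀⟶∃¬-restricted (_∈? S) (cross-sum? x y u) (λ all → ¬all λ v → all v)
  ...   | v , v∈S , ¬E = u , v , u∈S , v∈S ,
          λ eq → ¬E (+m-+n≡+o-+p⇒m+p≡o+n (d G u x) (d G u y) (d G v x) (d G v y) eq)

  unresolved-member : ∀ {S x y} → Unresolved S x y → x ∈ S → x ≡ y
  unresolved-member {x = x} unresolved x∈S = d≡0⇒≡ (trans (sym (unresolved x x∈S)) (d-refl x))

  doublyResolving⇒resolving : ∀ S → IsDoublyResolving G S → IsResolving G S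
  doublyResolving⇒resolving S doublyResolving = ¬unresolved⇒resolving λ x y x≢y unresolved →
    let u , v , u∈S , v∈S , resolved = doublyResolving x y x≢y
    in resolved (trans (i≡j⇒i-j≡0 (cong +_ (unresolved u u∈S)))
                       (sym (i≡j⇒i-j≡0 (cong +_ (unresolved v v∈S)))))

  unresolved-sym : ∀ {S x y} → Unresolved S x y → Unresolved S y x
  unresolved-sym unresolved u u∈S = sym (unresolved u u∈S)

  unresolved⇒N∩⊆N∩ : ∀ {S x y} → Unresolved S x y → N G x ∩ S ⊆ N G y ∩ S
  unresolved⇒N∩⊆N∩ {S} {x} {y} unresolved w∈ with x∈p∩q⁻ (N G x) S w∈
  ... | w∈Nx , w∈S = x∈p∩q⁺ (∈-tabulate⁺ (adj G y) y-adj-w , w∈S)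
    where
    y-adj-w : adj G y _ ≡ true
    y-adj-w = adj-sym (d≡1⇒adj (trans (sym (unresolved _ w∈S)) (adj⇒d≡1 (adj-sym (∈-tabulate⁻ (adj G x) w∈Nx)))))

  locatingDominating⇒metricLocatingDominating : ∀ S → IsLocatingDominating G S →
                                                IsMetricLocatingDominating G S
  locatingDominating⇒metricLocatingDominating S (dominating , locating) =
    ¬unresolved⇒resolving separated , dominating
    where
    separated : ∀ x y → x ≢ y → ¬ Unresolved S x y
    separated x y x≢y unresolved with x ∈? S | y ∈? S
    ... | yes x∈S | _       = x≢y (unresolved-member unresolved x∈S)
    ... | no _    | yes y∈S = x≢y (sym (unresolved-member (unresolved-sym unresolved) y∈S))
    ... | no x∉S  | no y∉S  = locating x y x≢y x∉S y∉S
      (⊆-antisym (unresolved⇒N∩⊆N∩ unresolved) (unresolved⇒N∩⊆N∩ (unresolved-sym unresolved)))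

  doublyUnresolved-sym : ∀ {S x y} → DoublyUnresolved S x y → DoublyUnresolved S y x
  doublyUnresolved-sym {x = x} {y} unresolved u v u∈S v∈S =
    trans (+-comm (d G u y) (d G v x)) (trans (unresolved v u v∈S u∈S) (+-comm (d G u x) (d G v y)))

  private
    module Doubling (S : Subset (n G)) (resolving : IsResolving G S) (dominating : IsDominating G S) where

      Beyond : V → V → Set
      Beyond s x = s ∈ S × (∀ s′ → s′ ∈ S → d G s′ x ≡ d G s′ s + 1)

      beyond? : ∀ s → Decidable (Beyond s)
      beyond? s x = (s ∈? S) ×-dec all? (λ s′ → (s′ ∈? S) →-dec (d G s′ x ℕ.≟ d G s′ s + 1))

      beyond-unique : ∀ {s x y} → Beyond s x → Beyond s y → x ≡ y
      beyond-unique {x = x} {y} (_ , sx) (_ , sy) with x ≟ y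
      ... | yes x≡y = x≡y
      ... | no x≢y  = ⊥-elim (resolving⇒¬unresolved resolving x≢y
                        λ u u∈S → trans (sx u u∈S) (sym (sy u u∈S)))

      extension : Subset (n G)
      extension = ⋃ (List.tabulate λ s → filter (beyond? s))

      S′ : Subset (n G)
      S′ = S ∪ extension

      S⊆S′ : S ⊆ S′
      S⊆S′ = p⊆p∪q extension

      beyond⇒∈S′ : ∀ {s x} → Beyond s x → x ∈ S′
      beyond⇒∈S′ {s} sx = q⊆p∪q S extension (∈⋃-tabulate⁺ _ s (∈-filter⁺ (beyond? s) sx))

      ∣extension∣≤∣S∣ : ∣ extension ∣ ≤ ∣ S ∣
      ∣extension∣≤∣S∣ = ∣⋃∣≤∣p∣ _ S at-most-one outside-empty
        where
        at-most-one : ∀ s → ∣ filter (beyond? s) ∣ ≤ 1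
        at-most-one s = ∣p∣≤1 _ λ x∈ y∈ → beyond-unique (∈-filter⁻ (beyond? s) x∈) (∈-filter⁻ (beyond? s) y∈)
        outside-empty : ∀ s → s ∉ S → ∣ filter (beyond? s) ∣ ≡ 0
        outside-empty s s∉S = trans (cong ∣_∣ (Empty-unique λ (x , x∈) → s∉S (proj₁ (∈-filter⁻ (beyond? s) x∈))))
                                    (∣⊥∣≡0 (n G))

      ∣S′∣≤2∣S∣ : ∣ S′ ∣ ≤ 2 * ∣ S ∣
      ∣S′∣≤2∣S∣ rewrite +-identityʳ ∣ S ∣ =
        ≤-trans (∣p∪q∣≤∣p∣+∣q∣ S extension) (+-monoʳ-≤ ∣ S ∣ ∣extension∣≤∣S∣)

      member-resolved : ∀ {x y} → x ≢ y → x ∈ S′ → ¬ DoublyUnresolved S′ x y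
      member-resolved {x} {y} x≢y x∈S′ unresolved with y ∈? S′
      ... | yes y∈S′ = x≢y (sym (d≡0⇒≡ (m+n≡0⇒m≡0 (d G y x)
                         (trans (unresolved y x y∈S′ x∈S′) (cong₂ _+_ (d-refl x) (d-refl y))))))
      ... | no y∉S′ with dominating y (y∉S′ ∘ S⊆S′)
      ...   | s , s∈S , ys with d≡0⇒≡ (m+n≡1⇒m≡0 (d G s x) (d G x y) sx+xy≡1 (x≢y ∘ d≡0⇒≡))
        where
        sx+xy≡1 : d G s x + d G x y ≡ 1
        sx+xy≡1 = trans (unresolved s x (S⊆S′ s∈S) x∈S′) (cong₂ _+_ (d-refl x) (adj⇒d≡1 (adj-sym ys)))
      ...     | refl = y∉S′ (beyond⇒∈S′ (s∈S , y-beyond))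
        where
        sy≡1 : d G s y ≡ 1
        sy≡1 = adj⇒d≡1 (adj-sym ys)
        y-beyond : ∀ s′ → s′ ∈ S → d G s′ y ≡ d G s′ s + 1
        y-beyond s′ s′∈S = begin
          d G s′ y               ≡⟨ cong (_+ d G s′ y) (d-refl s) ⟨
          d G s s + d G s′ y     ≡⟨ unresolved s′ s (S⊆S′ s′∈S) x∈S′ ⟨
          d G s′ s + d G s y     ≡⟨ cong (λ k → d G s′ s + k) sy≡1 ⟩
          d G s′ s + 1           ∎
          where open ≡-Reasoning

      outside-resolved : ∀ {x y} → x ≢ y → x ∉ S′ → y ∉ S′ → ¬ DoublyUnresolved S′ x y
      outside-resolved {x} {y} x≢y x∉S′ y∉S′ unresolved
        with dominating x (x∉S′ ∘ S⊆S′) | dominating y (y∉S′ ∘ S⊆S′)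
      ... | sx , sx∈S , xsx | sy , sy∈S , ysy =
        resolving⇒¬unresolved resolving x≢y λ s s∈S → suc-injective (begin
          suc (d G s x)          ≡⟨ +-comm 1 (d G s x) ⟩
          d G s x + 1            ≡⟨ cong (λ k → d G s x + k) sx-y≡1 ⟨
          d G s x + d G sx y     ≡⟨ unresolved s sx (S⊆S′ s∈S) (S⊆S′ sx∈S) ⟩
          d G sx x + d G s y     ≡⟨ cong (_+ d G s y) sx-x≡1 ⟩
          suc (d G s y)          ∎)
        where
        open ≡-Reasoning
        sx-x≡1 : d G sx x ≡ 1
        sx-x≡1 = adj⇒d≡1 (adj-sym xsx)
        sx-y≡1 : d G sx y ≡ 1
        sx-y≡1 = m+n≡2⇒n≡1 (d G sy x) (d G sx y)
          (trans (sym (unresolved sx sy (S⊆S′ sx∈S) (S⊆S′ sy∈S))) (cong₂ _+_ sx-x≡1 (adj⇒d≡1 (adj-sym ysy))))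
          (λ sy-x≡0 → x∉S′ (S⊆S′ (subst (_∈ S) (d≡0⇒≡ sy-x≡0) sy∈S)))
          (λ sx-y≡0 → y∉S′ (S⊆S′ (subst (_∈ S) (d≡0⇒≡ sx-y≡0) sx∈S)))

      S′-doublyResolving : IsDoublyResolving G S′
      S′-doublyResolving = ¬doublyUnresolved⇒doublyResolving resolved
        where
        resolved : ∀ x y → x ≢ y → ¬ DoublyUnresolved S′ x y
        resolved x y x≢y with x ∈? S′ | y ∈? S′
        ... | yes x∈S′ | _        = member-resolved x≢y x∈S′
        ... | no _     | yes y∈S′ = member-resolved (x≢y ∘ sym) y∈S′ ∘ doublyUnresolved-sym
        ... | no x∉S′  | no y∉S′  = outside-resolved x≢y x∉S′ y∉S′

  metricLocatingDominating⇒doublyResolving : ∀ S → IsMetricLocatingDominating G S →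
    Σ (Subset (n G)) λ S′ → IsDoublyResolving G S′ × ∣ S′ ∣ ≤ 2 * ∣ S ∣
  metricLocatingDominating⇒doublyResolving S (resolving , dominating) =
    S′ , S′-doublyResolving , ∣S′∣≤2∣S∣
    where open Doubling S resolving dominating

corollary2 : (G : Graph) (dm ps gM gL : ℕ) →
    IsDim G dm → IsPsi G ps → IsGammaM G gM → IsGammaL G gL →
    dm ≤ ps × ps ≤ 2 * gM × 2 * gM ≤ 2 * gL
corollary2 G dm ps gM gL (_ , dim-min) ((Sψ , doublyResolving , ∣Sψ∣≡ps) , ψ-min)
           ((SM , metricLocDom , ∣SM∣≡gM) , γM-min) ((SL , locDom , ∣SL∣≡gL) , _) =
  dim≤ψ , ψ≤2γM , *-monoʳ-≤ 2 γM≤γL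
  where
  dim≤ψ : dm ≤ ps
  dim≤ψ = subst (dm ≤_) ∣Sψ∣≡ps (dim-min Sψ (doublyResolving⇒resolving G Sψ doublyResolving))
  ψ≤2γM : ps ≤ 2 * gM
  ψ≤2γM =
    let S′ , S′-doublyResolving , ∣S′∣≤2∣SM∣ = metricLocatingDominating⇒doublyResolving G SM metricLocDom
    in subst (λ k → ps ≤ 2 * k) ∣SM∣≡gM (≤-trans (ψ-min S′ S′-doublyResolving) ∣S′∣≤2∣SM∣)
  γM≤γL : gM ≤ gL
  γM≤γL = subst (gM ≤_) ∣SL∣≡gL (γM-min SL (locatingDominating⇒metricLocatingDominating G SL locDom))
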